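{- For all integers $m\ge 2$ and $d\ge 1$ there exists a subdivision $W$ of $\hat{T}_{m,d}$ with $i_{1,1}(W)\le 2$.
   Context: Discrete-time immunization model with $r=s=1$. For a finite graph $H$, a protocol is a finite sequence $(A_1,\dots,A_N)$ of subsets of $V(H)$ (vertices immunized at time-step $t$); its width is $\max_i|A_i|$. At time $0$ all vertices are red. For $t\ge1$ each vertex is green, yellow or red at time $t$: if $v\in A_t$ then $v$ is green; otherwise, a vertex red or yellow at time $t-1$ is red at time $t$, and a vertex green at time $t-1$ becomes yellow at time $t$ if it has a neighbor that is red at time $t$, and stays green otherwise. The protocol clears $H$ if all vertices are green at time $N$. $i_{1,1}(H)$ is the minimum width of a protocol that clears $H$. $T_{m,d}$ is the complete $m$-ary tree of depth $d$ (a rooted tree in which every non-leaf vertex has exactly $m$ children and all leaves are at depth $d$), and $\hat{T}_{m,d}$ is obtained from $T_{m,d}$ by attaching a new leaf (the stem) to the root. A subdivision of a graph is obtained by replacing edges by paths with new internal vertices. -}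

module Defs where

open import Data.Nat using (ℕ; zero; suc; _+_; _*_; _≤_; _≡ᵇ_)
open import Data.Bool using (Bool; true; false; _∧_; _∨_; not; if_then_else_)
open import Data.List using (List; []; _∷_; _++_; map; length; upTo)
open import Data.Bool.ListAction using (any)
open import Relation.Binary.PropositionalEquality using (_≡_)
open import Data.List.Relation.Unary.All using (All)
open import Data.Product using (_×_; _,_; Σ; ∃)
open import Data.Vec using (Vec; []; _∷_)

-- Finite graphs: vertex set {0,…,size-1}, undirected edges given by a list
-- of (unordered) pairs.

record Graph : Set where
  constructor mkGraph
  field
    size  : ℕ
    edges : List (ℕ × ℕ)
open Graph public

vertices : Graph → List ℕ
vertices G = upTo (size G)

adj : Graph → ℕ → ℕ → Bool
adj G u v = any (λ { (a , b) → ((a ≡ᵇ u) ∧ (b ≡ᵇ v)) ∨ ((a ≡ᵇ v) ∧ (b ≡ᵇ u)) }) (edges G)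

shiftE : ℕ → List (ℕ × ℕ) → List (ℕ × ℕ)
shiftE o = map (λ { (a , b) → (o + a , o + b) })

-- m copies of a rooted tree with k vertices and edges E, placed at offsets
-- 1 + i*k (i < m), each copy's root joined to vertex 0.
copies : ℕ → ℕ → List (ℕ × ℕ) → List (ℕ × ℕ)
copies zero    k E = []
copies (suc i) k E = ((0 , 1 + i * k) ∷ shiftE (1 + i * k) E) ++ copies i k E

T : ℕ → ℕ → Graph
T m zero    = mkGraph 1 []
T m (suc d) = mkGraph (1 + m * size (T m d)) (copies m (size (T m d)) (edges (T m d)))

That : ℕ → ℕ → Graph
That m d = mkGraph (suc (size (T m d))) ((0 , size (T m d)) ∷ edges (T m d))

-- Subdivision: replace each edge by a path with the prescribed number of
-- new internal vertices (new vertices get fresh labels starting at `base`).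

path : ℕ → ℕ → ℕ → ℕ → List (ℕ × ℕ)
path u v base zero    = (u , v) ∷ []
path u v base (suc k) = (u , base) ∷ path base v (suc base) k

subdivEdges : (E : List (ℕ × ℕ)) → Vec ℕ (length E) → ℕ → List (ℕ × ℕ) × ℕ
subdivEdges []             []       base = [] , base
subdivEdges ((u , v) ∷ E) (k ∷ ks) base with subdivEdges E ks (base + k)
... | E' , n' = path u v base k ++ E' , n'

subdivide : (G : Graph) → Vec ℕ (length (edges G)) → Graph
subdivide G ks with subdivEdges (edges G) ks (size G)
... | E' , n' = mkGraph n' E'

IsSubdivisionOf : Graph → Graph → Set
IsSubdivisionOf W H = Σ (Vec ℕ (length (edges H))) (λ ks → subdivide H ks ≡ W)

-- Immunization model with r = s = 1.

data Colour : Set where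
  green yellow red : Colour

isGreen : Colour → Bool
isGreen green = true
isGreen _     = false

mem : ℕ → List ℕ → Bool
mem v A = any (v ≡ᵇ_) A

step : Graph → (ℕ → Colour) → List ℕ → (ℕ → Colour)
step G c A v = if mem v A then green else next (c v)
  where
  redNow : ℕ → Bool
  redNow u = not (mem u A) ∧ not (isGreen (c u))
  next : Colour → Colour
  next green  = if any (λ u → adj G u v ∧ redNow u) (vertices G) then yellow else green
  next yellow = red
  next red    = red

allRed : ℕ → Colour
allRed _ = red

run : Graph → (ℕ → Colour) → List (List ℕ) → (ℕ → Colour)
run G c []       = c
run G c (A ∷ P)  = run G (step G c A) P

-- A protocol is a finite list of sets A_1,…,A_N (each given as a list of vertices).
Clears : Graph → List (List ℕ) → Set
Clears G P = All (λ v → isGreen (run G allRed P v) ≡ true) (vertices G)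

HasWidth≤ : ℕ → List (List ℕ) → Set
HasWidth≤ k P = All (λ A → length A ≤ k) P

-- i_{1,1}(G) ≤ k  (i_{1,1} is a minimum, so this means some protocol of
-- width ≤ k clears G)
i11≤ : Graph → ℕ → Set
i11≤ G k = Σ (List (List ℕ)) (λ P → HasWidth≤ k P × Clears G P)

-- Subdivide the edge from a vertex to each child by as many vertices as it takes to clear
-- the children handled after it, and clear the tree from the leaves up. To clear the
-- children of a red vertex r, take them one at a time: clear the child's subtree, then
-- immunise its path bottom-up, one vertex per step. While the later children are cleared,
-- red re-enters the path from r but advances one vertex per step, so the path is long
-- enough to keep the subtree green. Afterwards the path is swept bottom-up once more,
-- immunising r alongside each path vertex so that the children already cleared stay
-- green. Finally r is immunised, and at the very end the stem. No step immunises more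
-- than two vertices.

module Submission where

open import Defs
open import Data.Nat using (ℕ; zero; suc; _+_; _*_; _≤_; _<_; _≡ᵇ_; z≤n; s≤s; _<?_; _≟_)
open import Data.Nat.Properties
open import Data.Bool using (Bool; true; false; _∧_; not; if_then_else_)
open import Data.Bool.Properties using (∧-zeroʳ; ∨-zeroʳ; T-≡; T-∧; T-∨)
open import Data.Bool.ListAction using (any)
open import Data.List using (List; []; _∷_; _++_; length)
open import Data.List.Properties using (length-++; ++-assoc)
open import Data.List.Membership.Propositional using (_∈_; find)
open import Data.List.Membership.Propositional.Properties using (∈-++⁻)
open import Data.List.Relation.Unary.Any using (here; there)
open import Data.List.Relation.Unary.Any.Properties using (any⁻)
open import Data.List.Relation.Unary.All as All using ([]; _∷_)
open import Data.List.Relation.Unary.All.Properties using (++⁺; all-upTo)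
open import Data.Vec using (Vec; []; _∷_)
open import Data.Product using (Σ; _×_; _,_; proj₁; proj₂)
open import Data.Product.Properties using (,-injectiveˡ; ,-injectiveʳ)
open import Data.Sum using (_⊎_; inj₁; inj₂; [_,_]′)
open import Data.Empty using (⊥; ⊥-elim)
open import Data.Unit using (⊤; tt)
open import Function using (_∘_; Equivalence)
open import Relation.Binary.PropositionalEquality
open import Relation.Nullary using (yes; no)

Pred : Set₁
Pred = ℕ → Set

Green : (ℕ → Colour) → Pred
Green c v = isGreen (c v) ≡ true

Edge : List (ℕ × ℕ) → ℕ → ℕ → Set
Edge E u v = (u , v) ∈ E ⊎ (v , u) ∈ E

adj⇒Edge : ∀ G {u v} → adj G u v ≡ true → Edge (edges G) u v
adj⇒Edge G {u} {v} h with find (any⁻ _ (edges G) (Equivalence.from T-≡ h))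
... | (a , b) , ab∈E , t with Equivalence.to T-∨ t
... | inj₁ t₁ with Equivalence.to T-∧ t₁
...   | a≡u , b≡v = inj₁ (subst (_∈ edges G) (cong₂ _,_ (≡ᵇ⇒≡ a u a≡u) (≡ᵇ⇒≡ b v b≡v)) ab∈E)
adj⇒Edge G {u} {v} h | (a , b) , ab∈E , t | inj₂ t₂ with Equivalence.to T-∧ t₂
...   | a≡v , b≡u = inj₂ (subst (_∈ edges G) (cong₂ _,_ (≡ᵇ⇒≡ a v a≡v) (≡ᵇ⇒≡ b u b≡u)) ab∈E)

mem-∷-here : ∀ u {s} X → u ≡ s → mem u (s ∷ X) ≡ true
mem-∷-here u X refl rewrite Equivalence.to T-≡ (≡⇒≡ᵇ u u refl) = refl

mem-∷-there : ∀ u s X → mem u X ≡ true → mem u (s ∷ X) ≡ true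
mem-∷-there u s X h rewrite h = ∨-zeroʳ (u ≡ᵇ s)

any-false : ∀ {A : Set} (p : A → Bool) xs → (∀ x → p x ≡ false) → any p xs ≡ false
any-false p []       h = refl
any-false p (x ∷ xs) h rewrite h x = any-false p xs h

step-immunised : ∀ G c {A v} → mem v A ≡ true → Green (step G c A) v
step-immunised G c {A} {v} h rewrite h = refl

step-stays-green : ∀ G c A {v} → Green c v →
  (∀ u → adj G u v ≡ true → mem u A ≡ true ⊎ Green c u) → Green (step G c A) v
step-stays-green G c A {v} gv h with mem v A
... | true = refl
... | false with c v
...   | green = cong (λ b → isGreen (if b then yellow else green))
                      (any-false _ (vertices G) no-red-neighbour)
  where
  no-red-neighbour : ∀ u → (adj G u v ∧ (not (mem u A) ∧ not (isGreen (c u)))) ≡ false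
  no-red-neighbour u with adj G u v in e
  ... | false = refl
  ... | true with h u e
  ...   | inj₁ m rewrite m = refl
  ...   | inj₂ g rewrite g = ∧-zeroʳ _
step-stays-green G c A () h | false | yellow
step-stays-green G c A () h | false | red

-- Hoare triples {S green} P {S' green} for protocols P.
Triple : Graph → Pred → List (List ℕ) → Pred → Set
Triple G S P S' = ∀ c → (∀ v → S v → Green c v) → ∀ v → S' v → Green (run G c P) v

run-++ : ∀ G c P Q → run G c (P ++ Q) ≡ run G (run G c P) Q
run-++ G c []      Q = refl
run-++ G c (A ∷ P) Q = run-++ G (step G c A) P Q

triple-++ : ∀ {G S S₁ S₂} P Q → Triple G S P S₁ → Triple G S₁ Q S₂ → Triple G S (P ++ Q) S₂
triple-++ {G} P Q t₁ t₂ c h v s rewrite run-++ G c P Q = t₂ (run G c P) (t₁ c h) v s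

triple-[] : ∀ {G S S'} → (∀ v → S' v → S v) → Triple G S [] S'
triple-[] f c h v s = h v (f v s)

triple-consequence : ∀ {G S S₁ S₁' S'} P → (∀ v → S₁ v → S v) → Triple G S₁ P S₁' →
  (∀ v → S' v → S₁' v) → Triple G S P S'
triple-consequence P f t g c h v s = t c (λ w x → h w (f w x)) v (g v s)

triple-step : ∀ {G S S'} A →
  (∀ v → S' v → mem v A ≡ true ⊎ (S v × (∀ u → Edge (edges G) u v → mem u A ≡ true ⊎ S u))) →
  Triple G S (A ∷ []) S'
triple-step {G} A f c h v s with f v s
... | inj₁ m        = step-immunised G c m
... | inj₂ (x , nb) = step-stays-green G c A (h v x)
                        (λ u e → [ inj₁ , inj₂ ∘ h u ]′ (nb u (adj⇒Edge G e)))

-- A rooted tree whose edges to the children have been subdivided: a branch lists the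
-- subdivision vertices of such an edge, from the parent down, followed by the subtree.
data Tree : Set
data Branches : Set

data Tree where
  node : ℕ → Branches → Tree

data Branches where
  [] : Branches
  branch : List ℕ → Tree → Branches → Branches

root : Tree → ℕ
root (node r _) = r

firstOf : List ℕ → ℕ → ℕ
firstOf []      c = c
firstOf (s ∷ _) c = s

lastOf : ℕ → List ℕ → ℕ
lastOf a []       = a
lastOf a (s ∷ es) = lastOf s es

InTree : Tree → Pred
InBranches : Branches → Pred
InBranch : List ℕ → Tree → Pred

InTree (node r bs) v = v ≡ r ⊎ InBranches bs v
InBranches []               v = ⊥
InBranches (branch es t bs) v = InBranch es t v ⊎ InBranches bs v
InBranch es t v = v ∈ es ⊎ InTree t v

BranchTop : Branches → Pred
BranchTop []               u = ⊥
BranchTop (branch es t bs) u = u ≡ firstOf es (root t) ⊎ BranchTop bs u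

sweep : List ℕ → List ℕ → List (List ℕ)
sweep X []       = []
sweep X (s ∷ es) = sweep X es ++ ((s ∷ X) ∷ [])

clear : Tree → List (List ℕ)
clearBranches : ℕ → Branches → List (List ℕ)

clear (node r bs) = clearBranches r bs ++ ((r ∷ []) ∷ [])
clearBranches r [] = []
clearBranches r (branch es t bs) =
  (clear t ++ sweep [] es) ++ (clearBranches r bs ++ sweep (r ∷ []) es)

-- The E-neighbours of each vertex are its neighbours in the tree (up being the neighbour
-- of the root outside it), and each path is at least as long as the protocol clearing
-- the later branches, so that red entering from the parent cannot cross it meanwhile.
WfPath : List (ℕ × ℕ) → ℕ → List ℕ → ℕ → Set
WfPath E a []       c = ⊤
WfPath E a (s ∷ es) c = (∀ u → Edge E u s → u ≡ a ⊎ u ≡ firstOf es c) × WfPath E s es c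

WfTree : List (ℕ × ℕ) → ℕ → Tree → Set
WfBranches : List (ℕ × ℕ) → ℕ → Branches → Set

WfTree E up (node r bs) = (∀ u → Edge E u r → u ≡ up ⊎ BranchTop bs u) × WfBranches E r bs
WfBranches E r [] = ⊤
WfBranches E r (branch es t bs) =
  WfPath E r es (root t) × WfTree E (lastOf r es) t × WfBranches E r bs ×
  length (clearBranches r bs) ≤ length es

root-InTree : ∀ t → InTree t (root t)
root-InTree (node r bs) = inj₁ refl

firstOf-InBranch : ∀ es t → InBranch es t (firstOf es (root t))
firstOf-InBranch []       t = inj₂ (root-InTree t)
firstOf-InBranch (s ∷ es) t = inj₁ (here refl)

InBranch-∷ : ∀ s es t {v} → InBranch es t v → InBranch (s ∷ es) t v
InBranch-∷ s es t (inj₁ m) = inj₁ (there m)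
InBranch-∷ s es t (inj₂ x) = inj₂ x

BranchTop⇒InBranches : ∀ bs {u} → BranchTop bs u → InBranches bs u
BranchTop⇒InBranches (branch es t bs) (inj₁ refl) = inj₁ (firstOf-InBranch es t)
BranchTop⇒InBranches (branch es t bs) (inj₂ x)    = inj₂ (BranchTop⇒InBranches bs x)

neighbour-InTree : ∀ {E up} t → WfTree E up t →
  ∀ {u v} → InTree t v → Edge E u v → InTree t u ⊎ u ≡ up
neighbour-InBranches : ∀ {E r} bs → WfBranches E r bs →
  ∀ {u v} → InBranches bs v → Edge E u v → InBranches bs u ⊎ u ≡ r
neighbour-InBranch : ∀ {E a} es t → WfPath E a es (root t) → WfTree E (lastOf a es) t →
  ∀ {u v} → InBranch es t v → Edge E u v → InBranch es t u ⊎ u ≡ a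

neighbour-InTree (node r bs) (wr , wbs) (inj₁ refl) e with wr _ e
... | inj₁ u≡up = inj₂ u≡up
... | inj₂ top  = inj₁ (inj₂ (BranchTop⇒InBranches bs top))
neighbour-InTree (node r bs) (wr , wbs) (inj₂ x) e with neighbour-InBranches bs wbs x e
... | inj₁ y   = inj₁ (inj₂ y)
... | inj₂ u≡r = inj₁ (inj₁ u≡r)

neighbour-InBranches (branch es t bs) (wp , wt , wbs , _) (inj₁ x) e =
  [ inj₁ ∘ inj₁ , inj₂ ]′ (neighbour-InBranch es t wp wt x e)
neighbour-InBranches (branch es t bs) (wp , wt , wbs , _) (inj₂ x) e =
  [ inj₁ ∘ inj₂ , inj₂ ]′ (neighbour-InBranches bs wbs x e)

neighbour-InBranch []       t wp wt (inj₂ x) e = [ inj₁ ∘ inj₂ , inj₂ ]′ (neighbour-InTree t wt x e)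
neighbour-InBranch (s ∷ es) t (ws , wp) wt (inj₁ (here refl)) e with ws _ e
... | inj₁ u≡a    = inj₂ u≡a
... | inj₂ refl   = inj₁ (InBranch-∷ s es t (firstOf-InBranch es t))
neighbour-InBranch (s ∷ es) t (ws , wp) wt (inj₁ (there m)) e with neighbour-InBranch es t wp wt (inj₁ m) e
... | inj₁ y    = inj₁ (InBranch-∷ s es t y)
... | inj₂ refl = inj₁ (inj₁ (here refl))
neighbour-InBranch (s ∷ es) t (ws , wp) wt (inj₂ x) e with neighbour-InBranch es t wp wt (inj₂ x) e
... | inj₁ y    = inj₁ (InBranch-∷ s es t y)
... | inj₂ refl = inj₁ (inj₁ (here refl))

-- Each step, red can advance by at most one vertex along the path.
subtree-survives : ∀ G {a} es t → WfPath (edges G) a es (root t) → WfTree (edges G) (lastOf a es) t →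
  ∀ P → length P ≤ length es → Triple G (InBranch es t) P (InTree t)
subtree-survives G es       t wp       wt []      _         c h v x = h v (inj₂ x)
subtree-survives G (s ∷ es) t (_ , wp) wt (A ∷ P) (s≤s len) c h =
  subtree-survives G es t wp wt P len (step G c A) still-green
  where
  still-green : ∀ w → InBranch es t w → Green (step G c A) w
  still-green w y = step-stays-green G c A (h w (InBranch-∷ s es t y)) λ u e →
    inj₂ (h u ([ InBranch-∷ s es t , (λ { refl → inj₁ (here refl) }) ]′
                (neighbour-InBranch es t wp wt y (adj⇒Edge G e))))

sweep-triple : ∀ G {a} es t X (Q : Pred) → WfPath (edges G) a es (root t) →
  WfTree (edges G) (lastOf a es) t →
  (∀ v → Q v → ∀ u → Edge (edges G) u v → Q u ⊎ mem u X ≡ true) →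
  Triple G (λ v → Q v ⊎ InTree t v) (sweep X es) (λ v → Q v ⊎ InBranch es t v)
sweep-triple G []       t X Q wp       wt hQ =
  triple-[] {G} λ { v (inj₁ q) → inj₁ q ; v (inj₂ (inj₂ x)) → inj₂ x }
sweep-triple G (s ∷ es) t X Q (_ , wp) wt hQ =
  triple-++ (sweep X es) _ (sweep-triple G es t X Q wp wt hQ) (triple-step (s ∷ X) green-after)
  where
  inside : ∀ {v} → InBranch es t v → ∀ u → Edge (edges G) u v →
    mem u (s ∷ X) ≡ true ⊎ (Q u ⊎ InBranch es t u)
  inside y u e = [ inj₂ ∘ inj₂ , inj₁ ∘ mem-∷-here u X ]′ (neighbour-InBranch es t wp wt y e)
  green-after : ∀ v → Q v ⊎ InBranch (s ∷ es) t v → mem v (s ∷ X) ≡ true ⊎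
    ((Q v ⊎ InBranch es t v) × (∀ u → Edge (edges G) u v → mem u (s ∷ X) ≡ true ⊎ (Q u ⊎ InBranch es t u)))
  green-after v (inj₁ q) =
    inj₂ (inj₁ q , λ u e → [ inj₂ ∘ inj₁ , inj₁ ∘ mem-∷-there u s X ]′ (hQ v q u e))
  green-after v (inj₂ (inj₁ (here refl))) = inj₁ (mem-∷-here v X refl)
  green-after v (inj₂ (inj₁ (there m)))   = inj₂ (inj₂ (inj₁ m) , inside (inj₁ m))
  green-after v (inj₂ (inj₂ x))           = inj₂ (inj₂ (inj₂ x) , inside (inj₂ x))

clear-triple : ∀ G {up} t → WfTree (edges G) up t → Triple G (λ _ → ⊥) (clear t) (InTree t)
clearBranches-triple : ∀ G {r} bs → WfBranches (edges G) r bs →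
  Triple G (λ _ → ⊥) (clearBranches r bs) (InBranches bs)

clear-triple G (node r bs) (_ , wbs) =
  triple-++ (clearBranches r bs) _ (clearBranches-triple G bs wbs) (triple-step (r ∷ []) green-after)
  where
  green-after : ∀ v → InTree (node r bs) v → mem v (r ∷ []) ≡ true ⊎
    (InBranches bs v × (∀ u → Edge (edges G) u v → mem u (r ∷ []) ≡ true ⊎ InBranches bs u))
  green-after v (inj₁ v≡r) = inj₁ (mem-∷-here v [] v≡r)
  green-after v (inj₂ x)   =
    inj₂ (x , λ u e → [ inj₂ , inj₁ ∘ mem-∷-here u [] ]′ (neighbour-InBranches bs wbs x e))

clearBranches-triple G [] _ = triple-[] {G} λ v ()
clearBranches-triple G {r} (branch es t bs) (wp , wt , wbs , len) =
  triple-++ (clear t ++ sweep [] es) (clearBranches r bs ++ sweep (r ∷ []) es)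
    (triple-++ (clear t) (sweep [] es) (clear-triple G t wt)
      (triple-consequence (sweep [] es) (λ { v (inj₂ x) → x })
        (sweep-triple G es t [] (λ _ → ⊥) wp wt λ v ())
        (λ v → inj₂)))
    (triple-++ (clearBranches r bs) (sweep (r ∷ []) es) later-branches
      (triple-consequence (sweep (r ∷ []) es) (λ v x → x)
        (sweep-triple G es t (r ∷ []) (InBranches bs) wp wt closed-but-r)
        (λ v → [ inj₂ , inj₁ ]′)))
  where
  later-branches : Triple G (InBranch es t) (clearBranches r bs) (λ v → InBranches bs v ⊎ InTree t v)
  later-branches c h v (inj₁ x) = clearBranches-triple G bs wbs c (λ w ()) v x
  later-branches c h v (inj₂ x) = subtree-survives G es t wp wt (clearBranches r bs) len c h v x
  closed-but-r : ∀ v → InBranches bs v → ∀ u → Edge (edges G) u v → InBranches bs u ⊎ mem u (r ∷ []) ≡ true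
  closed-but-r v x u e = [ inj₁ , inj₂ ∘ mem-∷-here u [] ]′ (neighbour-InBranches bs wbs x e)

clear-stemmed-triple : ∀ G {s} t → WfTree (edges G) s t →
  Triple G (λ _ → ⊥) (clear t ++ ((s ∷ []) ∷ [])) (λ v → InTree t v ⊎ v ≡ s)
clear-stemmed-triple G {s} t wt = triple-++ (clear t) _ (clear-triple G t wt) (triple-step (s ∷ []) green-after)
  where
  green-after : ∀ v → InTree t v ⊎ v ≡ s → mem v (s ∷ []) ≡ true ⊎
    (InTree t v × (∀ u → Edge (edges G) u v → mem u (s ∷ []) ≡ true ⊎ InTree t u))
  green-after v (inj₂ v≡s) = inj₁ (mem-∷-here v [] v≡s)
  green-after v (inj₁ x)   = inj₂ (x , λ u e → [ inj₂ , inj₁ ∘ mem-∷-here u [] ]′ (neighbour-InTree t wt x e))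

triple⇒Clears : ∀ G P {S} → Triple G (λ _ → ⊥) P S → (∀ {v} → v < size G → S v) → Clears G P
triple⇒Clears G P t cover = All.map (λ v<size → t allRed (λ _ ()) _ (cover v<size)) (all-upTo (size G))

sweep-width : ∀ {X} es → length X ≤ 1 → HasWidth≤ 2 (sweep X es)
sweep-width []       _ = []
sweep-width (s ∷ es) h = ++⁺ (sweep-width es h) (s≤s h ∷ [])

clear-width : ∀ t → HasWidth≤ 2 (clear t)
clearBranches-width : ∀ r bs → HasWidth≤ 2 (clearBranches r bs)

clear-width (node r bs) = ++⁺ (clearBranches-width r bs) (s≤s z≤n ∷ [])
clearBranches-width r [] = []
clearBranches-width r (branch es t bs) =
  ++⁺ (++⁺ (clear-width t) (sweep-width es z≤n)) (++⁺ (clearBranches-width r bs) (sweep-width es (s≤s z≤n)))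

length-sweep : ∀ X es → length (sweep X es) ≡ length es
length-sweep X []       = refl
length-sweep X (s ∷ es) rewrite length-++ (sweep X es) {(s ∷ X) ∷ []} | length-sweep X es = +-comm (length es) 1

length-clearBranches-branch : ∀ r es t bs → length (clearBranches r (branch es t bs)) ≡
  (length (clear t) + length es) + (length (clearBranches r bs) + length es)
length-clearBranches-branch r es t bs = begin
  length ((clear t ++ sweep [] es) ++ (clearBranches r bs ++ sweep (r ∷ []) es))
    ≡⟨ length-++ (clear t ++ sweep [] es) ⟩
  length (clear t ++ sweep [] es) + length (clearBranches r bs ++ sweep (r ∷ []) es)
    ≡⟨ cong₂ _+_ (length-++ (clear t)) (length-++ (clearBranches r bs)) ⟩
  (length (clear t) + length (sweep [] es)) + (length (clearBranches r bs) + length (sweep (r ∷ []) es))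
    ≡⟨ cong₂ (λ p q → (length (clear t) + p) + (length (clearBranches r bs) + q))
             (length-sweep [] es) (length-sweep (r ∷ []) es) ⟩
  (length (clear t) + length es) + (length (clearBranches r bs) + length es) ∎
  where open ≡-Reasoning

Within : Pred → List (ℕ × ℕ) → Set
Within P E = ∀ a c → (a , c) ∈ E → P a × P c

Within-++ : ∀ {P} E₁ E₂ → Within P E₁ → Within P E₂ → Within P (E₁ ++ E₂)
Within-++ E₁ E₂ w₁ w₂ a c m = [ w₁ a c , w₂ a c ]′ (∈-++⁻ E₁ m)

Within-mono : ∀ {P P' E} → (∀ x → P x → P' x) → Within P E → Within P' E
Within-mono f w a c m = f a (proj₁ (w a c m)) , f c (proj₂ (w a c m))

Edge-within : ∀ {P E u x} → Within P E → Edge E u x → P x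
Edge-within {u = u} {x} w (inj₁ m) = proj₂ (w u x m)
Edge-within {u = u} {x} w (inj₂ m) = proj₁ (w x u m)

Edge-[] : ∀ {u x} → Edge [] u x → ⊥
Edge-[] (inj₁ ())
Edge-[] (inj₂ ())

Edge-∷⁻ : ∀ {p E u x} → Edge (p ∷ E) u x → (u , x) ≡ p ⊎ (x , u) ≡ p ⊎ Edge E u x
Edge-∷⁻ (inj₁ (here e))  = inj₁ e
Edge-∷⁻ (inj₂ (here e))  = inj₂ (inj₁ e)
Edge-∷⁻ (inj₁ (there m)) = inj₂ (inj₂ (inj₁ m))
Edge-∷⁻ (inj₂ (there m)) = inj₂ (inj₂ (inj₂ m))

Edge-++⁻ : ∀ E₁ E₂ {u x} → Edge (E₁ ++ E₂) u x → Edge E₁ u x ⊎ Edge E₂ u x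
Edge-++⁻ E₁ E₂ (inj₁ m) = [ inj₁ ∘ inj₁ , inj₂ ∘ inj₁ ]′ (∈-++⁻ E₁ m)
Edge-++⁻ E₁ E₂ (inj₂ m) = [ inj₁ ∘ inj₂ , inj₂ ∘ inj₂ ]′ (∈-++⁻ E₁ m)

Edge-++ʳ : ∀ {P} E₁ E₂ {u x} → Within P E₁ → (P x → ⊥) → Edge (E₁ ++ E₂) u x → Edge E₂ u x
Edge-++ʳ E₁ E₂ w x∉ e = [ ⊥-elim ∘ x∉ ∘ Edge-within w , (λ e₂ → e₂) ]′ (Edge-++⁻ E₁ E₂ e)

Edge-++ˡ : ∀ {P} E₁ E₂ {u x} → Within P E₂ → (P x → ⊥) → Edge (E₁ ++ E₂) u x → Edge E₁ u x
Edge-++ˡ E₁ E₂ w x∉ e = [ (λ e₁ → e₁) , ⊥-elim ∘ x∉ ∘ Edge-within w ]′ (Edge-++⁻ E₁ E₂ e)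

WfPath-extend : ∀ {E E' a} es c → (∀ {u x} → x ∈ es → Edge E' u x → Edge E u x) →
  WfPath E a es c → WfPath E' a es c
WfPath-extend []       c h w        = tt
WfPath-extend (s ∷ es) c h (ws , w) =
  (λ u e → ws u (h (here refl) e)) , WfPath-extend es c (h ∘ there) w

WfTree-extend : ∀ {E E' up} t → (∀ {u x} → InTree t x → Edge E' u x → Edge E u x) →
  WfTree E up t → WfTree E' up t
WfBranches-extend : ∀ {E E' r} bs → (∀ {u x} → InBranches bs x → Edge E' u x → Edge E u x) →
  WfBranches E r bs → WfBranches E' r bs

WfTree-extend (node r bs) h (wr , wbs) =
  (λ u e → wr u (h (inj₁ refl) e)) , WfBranches-extend bs (h ∘ inj₂) wbs
WfBranches-extend [] h w = tt
WfBranches-extend (branch es t bs) h (wp , wt , wbs , len) =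
  WfPath-extend es (root t) (h ∘ inj₁ ∘ inj₁) wp ,
  WfTree-extend t (h ∘ inj₁ ∘ inj₂) wt ,
  WfBranches-extend bs (h ∘ inj₂) wbs , len

WfTree-attach : ∀ {E E' up} r bs → (∀ {u x} → InBranches bs x → Edge E' u x → Edge E u x) →
  (∀ u → Edge E' u r → Edge E u r ⊎ u ≡ up) → WfTree E up (node r bs) → WfTree E' up (node r bs)
WfTree-attach r bs hbs hr (wr , wbs) =
  (λ u e → [ wr u , inj₁ ]′ (hr u e)) , WfBranches-extend bs hbs wbs

WfTree-stem : ∀ {E s} r bs → r ≢ s → (∀ {x} → InBranches bs x → x ≢ r × x ≢ s) →
  WfTree E s (node r bs) → WfTree ((r , s) ∷ E) s (node r bs)
WfTree-stem {E} {s} r bs r≢s away = WfTree-attach r bs not-stem at-root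
  where
  not-stem : ∀ {u x} → InBranches bs x → Edge ((r , s) ∷ E) u x → Edge E u x
  not-stem y e with away y | Edge-∷⁻ e
  ... | x≢r , x≢s | inj₁ eq        = ⊥-elim (x≢s (,-injectiveʳ eq))
  ... | x≢r , x≢s | inj₂ (inj₁ eq) = ⊥-elim (x≢r (,-injectiveˡ eq))
  ... | _         | inj₂ (inj₂ e') = e'
  at-root : ∀ u → Edge ((r , s) ∷ E) u r → Edge E u r ⊎ u ≡ s
  at-root u e with Edge-∷⁻ e
  ... | inj₁ eq        = ⊥-elim (r≢s (,-injectiveʳ eq))
  ... | inj₂ (inj₁ eq) = inj₂ (,-injectiveʳ eq)
  ... | inj₂ (inj₂ e') = inj₁ e'

range : ℕ → ℕ → List ℕ
range b zero    = []
range b (suc l) = b ∷ range (suc b) l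

Interval : ℕ → ℕ → Pred
Interval b l x = b ≤ x × x < b + l

Interval-empty : ∀ {b x} → Interval b 0 x → ⊥
Interval-empty {b} (b≤x , x<b+0) = <⇒≱ x<b+0 (subst (_≤ _) (sym (+-identityʳ b)) b≤x)

Interval-singleton : ∀ {b x} → Interval b 1 x → x ≡ b
Interval-singleton {b} {x} (b≤x , x<b+1) = ≤-antisym (m<1+n⇒m≤n (subst (x <_) (+-comm b 1) x<b+1)) b≤x

length-range : ∀ b l → length (range b l) ≡ l
length-range b zero    = refl
length-range b (suc l) = cong suc (length-range (suc b) l)

range⁻ : ∀ b l {x} → x ∈ range b l → Interval b l x
range⁻ b (suc l) (here refl) = ≤-refl , m<m+n b (s≤s z≤n)
range⁻ b (suc l) {x} (there m) with range⁻ (suc b) l m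
... | b<x , x<b+1+l = <⇒≤ b<x , subst (x <_) (sym (+-suc b l)) x<b+1+l

range⁺ : ∀ b l {x} → Interval b l x → x ∈ range b l
range⁺ b zero    i = ⊥-elim (Interval-empty i)
range⁺ b (suc l) {x} (b≤x , x<b+1+l) with b ≟ x
... | yes refl = here refl
... | no b≢x   = there (range⁺ (suc b) l (≤∧≢⇒< b≤x b≢x , subst (x <_) (+-suc b l) x<b+1+l))

PathVertex : ℕ → ℕ → ℕ → ℕ → Pred
PathVertex a c b l x = x ≡ a ⊎ x ≡ c ⊎ Interval b l x

path-within : ∀ a c b l → Within (PathVertex a c b l) (path a c b l)
path-within a c b zero    _ _ (here refl) = inj₁ refl , inj₂ (inj₁ refl)
path-within a c b (suc l) _ _ (here refl) = inj₁ refl , inj₂ (inj₂ (≤-refl , m<m+n b (s≤s z≤n)))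
path-within a c b (suc l) x y (there m) with path-within b c (suc b) l x y m
... | px , py = shift px , shift py
  where
  shift : ∀ {z} → PathVertex b c (suc b) l z → PathVertex a c b (suc l) z
  shift (inj₁ refl)             = inj₂ (inj₂ (≤-refl , m<m+n b (s≤s z≤n)))
  shift (inj₂ (inj₁ z≡c))       = inj₂ (inj₁ z≡c)
  shift {z} (inj₂ (inj₂ (b<z , z<))) = inj₂ (inj₂ (<⇒≤ b<z , subst (z <_) (sym (+-suc b l)) z<))

path-neighbour-start : ∀ {a c b} l {u} → a ≢ c → a < b → Edge (path a c b l) u a → u ≡ firstOf (range b l) c
path-neighbour-start zero    a≢c a<b e with Edge-∷⁻ e
... | inj₁ eq                = ⊥-elim (a≢c (,-injectiveʳ eq))
... | inj₂ (inj₁ eq)         = ,-injectiveʳ eq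
... | inj₂ (inj₂ (inj₁ ()))
... | inj₂ (inj₂ (inj₂ ()))
path-neighbour-start {c = c} {b} (suc l) a≢c a<b e with Edge-∷⁻ e
... | inj₁ eq        = ⊥-elim (<-irrefl (,-injectiveʳ eq) a<b)
... | inj₂ (inj₁ eq) = ,-injectiveʳ eq
... | inj₂ (inj₂ e') with Edge-within (path-within b c (suc b) l) e'
...   | inj₁ a≡b               = ⊥-elim (<-irrefl a≡b a<b)
...   | inj₂ (inj₁ a≡c)        = ⊥-elim (a≢c a≡c)
...   | inj₂ (inj₂ (b<a , _))  = ⊥-elim (<-asym a<b b<a)

path-neighbour-end : ∀ {a c b} l {u} → a ≢ c → c < b → Edge (path a c b l) u c → u ≡ lastOf a (range b l)
path-neighbour-end zero    a≢c c<b e with Edge-∷⁻ e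
... | inj₁ eq                = ,-injectiveˡ eq
... | inj₂ (inj₁ eq)         = ⊥-elim (a≢c (sym (,-injectiveˡ eq)))
... | inj₂ (inj₂ (inj₁ ()))
... | inj₂ (inj₂ (inj₂ ()))
path-neighbour-end {b = b} (suc l) a≢c c<b e with Edge-∷⁻ e
... | inj₁ eq        = ⊥-elim (<-irrefl (,-injectiveʳ eq) c<b)
... | inj₂ (inj₁ eq) = ⊥-elim (a≢c (sym (,-injectiveˡ eq)))
... | inj₂ (inj₂ e') = path-neighbour-end l (>⇒≢ c<b) (<-trans c<b (n<1+n b)) e'

path-wf : ∀ a c b l → a < b → c < b → WfPath (path a c b l) a (range b l) c
path-wf a c b zero    a<b c<b = tt
path-wf a c b (suc l) a<b c<b =
  neighbours-of-b , WfPath-extend (range (suc b) l) c not-at-a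
                      (path-wf b c (suc b) l (n<1+n b) (<-trans c<b (n<1+n b)))
  where
  neighbours-of-b : ∀ u → Edge ((a , b) ∷ path b c (suc b) l) u b → u ≡ a ⊎ u ≡ firstOf (range (suc b) l) c
  neighbours-of-b u e with Edge-∷⁻ e
  ... | inj₁ eq        = inj₁ (,-injectiveˡ eq)
  ... | inj₂ (inj₁ eq) = ⊥-elim (<-irrefl (sym (,-injectiveˡ eq)) a<b)
  ... | inj₂ (inj₂ e') = inj₂ (path-neighbour-start l (>⇒≢ c<b) (n<1+n b) e')
  not-at-a : ∀ {u x} → x ∈ range (suc b) l → Edge ((a , b) ∷ path b c (suc b) l) u x → Edge (path b c (suc b) l) u x
  not-at-a m e with range⁻ (suc b) l m | Edge-∷⁻ e
  ... | b<x , _ | inj₁ eq        = ⊥-elim (<-irrefl (sym (,-injectiveʳ eq)) b<x)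
  ... | b<x , _ | inj₂ (inj₁ eq) = ⊥-elim (<-irrefl (sym (,-injectiveˡ eq)) (<-trans a<b b<x))
  ... | _       | inj₂ (inj₂ e') = e'

Counts : List (ℕ × ℕ) → Set
Counts E = Vec ℕ (length E)

counts-++ : ∀ E₁ E₂ → Counts E₁ → Counts E₂ → Counts (E₁ ++ E₂)
counts-++ []       E₂ []        ks₂ = ks₂
counts-++ (_ ∷ E₁) E₂ (k ∷ ks₁) ks₂ = k ∷ counts-++ E₁ E₂ ks₁ ks₂

counts-shift : ∀ o E → Counts E → Counts (shiftE o E)
counts-shift o []      []       = []
counts-shift o (_ ∷ E) (k ∷ ks) = k ∷ counts-shift o E ks

subdivEdgesAt : ℕ → (E : List (ℕ × ℕ)) → Counts E → ℕ → List (ℕ × ℕ) × ℕ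
subdivEdgesAt o []            []       b = [] , b
subdivEdgesAt o ((u , x) ∷ E) (k ∷ ks) b =
  path (o + u) (o + x) b k ++ proj₁ (subdivEdgesAt o E ks (b + k)) , proj₂ (subdivEdgesAt o E ks (b + k))

subdivEdges≡subdivEdgesAt0 : ∀ E ks b → subdivEdges E ks b ≡ subdivEdgesAt 0 E ks b
subdivEdges≡subdivEdgesAt0 []            []       b = refl
subdivEdges≡subdivEdgesAt0 ((u , x) ∷ E) (k ∷ ks) b
  with subdivEdges E ks (b + k) | subdivEdges≡subdivEdgesAt0 E ks (b + k)
... | _ | refl = refl

subdivEdgesAt-++ : ∀ o E₁ E₂ ks₁ ks₂ b →
  let (E₁' , b₁) = subdivEdgesAt o E₁ ks₁ b
      (E₂' , b₂) = subdivEdgesAt o E₂ ks₂ b₁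
  in subdivEdgesAt o (E₁ ++ E₂) (counts-++ E₁ E₂ ks₁ ks₂) b ≡ (E₁' ++ E₂' , b₂)
subdivEdgesAt-++ o []            E₂ []       ks₂ b = refl
subdivEdgesAt-++ o ((u , x) ∷ E₁) E₂ (k ∷ ks₁) ks₂ b rewrite subdivEdgesAt-++ o E₁ E₂ ks₁ ks₂ (b + k) =
  cong (_, _) (sym (++-assoc (path (o + u) (o + x) b k) _ _))

subdivEdgesAt-shift : ∀ o o' E ks b →
  subdivEdgesAt o (shiftE o' E) (counts-shift o' E ks) b ≡ subdivEdgesAt (o + o') E ks b
subdivEdgesAt-shift o o' []            []       b = refl
subdivEdgesAt-shift o o' ((u , x) ∷ E) (k ∷ ks) b
  rewrite subdivEdgesAt-shift o o' E ks (b + k) | +-assoc o o' u | +-assoc o o' x = refl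

module Construction (m : ℕ) where

  order : ℕ → ℕ
  order h = size (T m h)

  copyOffset : ℕ → ℕ → ℕ
  copyOffset h i = 1 + i * order h

  -- clearLength h is the length of the protocol clearing the subdivided tree of height h,
  -- and pathLength i h that of clearing i branches of height h; the latter is also the
  -- number of vertices subdividing the edge to the next branch, which is cleared first.
  clearLength : ℕ → ℕ
  pathLength : ℕ → ℕ → ℕ

  clearLength zero    = 1
  clearLength (suc h) = pathLength m h + 1
  pathLength zero    h = 0
  pathLength (suc i) h = (clearLength h + pathLength i h) + (pathLength i h + pathLength i h)

  extra : ℕ → ℕ
  extraBranches : ℕ → ℕ → ℕ

  extra zero    = 0
  extra (suc h) = extraBranches h m
  extraBranches h zero    = 0
  extraBranches h (suc i) = (pathLength i h + extra h) + extraBranches h i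

  counts : (h : ℕ) → Counts (edges (T m h))
  countsCopies : (h i : ℕ) → Counts (copies i (order h) (edges (T m h)))

  counts zero    = []
  counts (suc h) = countsCopies h m
  countsCopies h zero    = []
  countsCopies h (suc i) =
    counts-++ ((0 , copyOffset h i) ∷ shiftE (copyOffset h i) (edges (T m h))) (copies i (order h) (edges (T m h)))
      (pathLength i h ∷ counts-shift (copyOffset h i) (edges (T m h)) (counts h)) (countsCopies h i)

  -- The subdivided tree of height h whose original vertices are o, o+1, … and whose
  -- subdivision vertices are b, b+1, …, numbered as subdivEdges numbers them.
  treeEdges : ℕ → ℕ → ℕ → List (ℕ × ℕ)
  branchesEdges : ℕ → ℕ → ℕ → ℕ → List (ℕ × ℕ)

  treeEdges zero    o b = []
  treeEdges (suc h) o b = branchesEdges h m o b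
  branchesEdges h zero    o b = []
  branchesEdges h (suc i) o b =
    path o (o + copyOffset h i) b (pathLength i h) ++
      (treeEdges h (o + copyOffset h i) (b + pathLength i h) ++
       branchesEdges h i o ((b + pathLength i h) + extra h))

  tree : ℕ → ℕ → ℕ → Tree
  subtrees : ℕ → ℕ → ℕ → Branches
  branches : ℕ → ℕ → ℕ → ℕ → Branches

  tree h o b = node o (subtrees h o b)
  subtrees zero    o b = []
  subtrees (suc h) o b = branches h m o b
  branches h zero    o b = []
  branches h (suc i) o b =
    branch (range b (pathLength i h)) (tree h (o + copyOffset h i) (b + pathLength i h))
      (branches h i o ((b + pathLength i h) + extra h))

  subdivEdgesAt-T : ∀ h o b → subdivEdgesAt o (edges (T m h)) (counts h) b ≡ (treeEdges h o b , b + extra h)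
  subdivEdgesAt-copies : ∀ h i o b →
    subdivEdgesAt o (copies i (order h) (edges (T m h))) (countsCopies h i) b ≡ (branchesEdges h i o b , b + extraBranches h i)

  subdivEdgesAt-T zero    o b = cong ([] ,_) (sym (+-identityʳ b))
  subdivEdgesAt-T (suc h) o b = subdivEdgesAt-copies h m o b
  subdivEdgesAt-copies h zero    o b = cong ([] ,_) (sym (+-identityʳ b))
  subdivEdgesAt-copies h (suc i) o b
    rewrite subdivEdgesAt-++ o (shiftE (copyOffset h i) (edges (T m h))) (copies i (order h) (edges (T m h)))
              (counts-shift (copyOffset h i) (edges (T m h)) (counts h)) (countsCopies h i) (b + pathLength i h)
          | subdivEdgesAt-shift o (copyOffset h i) (edges (T m h)) (counts h) (b + pathLength i h)
          | subdivEdgesAt-T h (o + copyOffset h i) (b + pathLength i h)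
          | subdivEdgesAt-copies h i o ((b + pathLength i h) + extra h)
          | +-identityʳ o
          | +-assoc b (pathLength i h) (extra h)
          | +-assoc b (pathLength i h + extra h) (extraBranches h i) = refl

  length-clear : ∀ h o b → length (clear (tree h o b)) ≡ clearLength h
  length-clearBranches : ∀ h i o b → length (clearBranches o (branches h i o b)) ≡ pathLength i h

  length-clear zero    o b = refl
  length-clear (suc h) o b
    rewrite length-++ (clearBranches o (branches h m o b)) {(o ∷ []) ∷ []} | length-clearBranches h m o b = refl
  length-clearBranches h zero    o b = refl
  length-clearBranches h (suc i) o b
    rewrite length-clearBranches-branch o (range b (pathLength i h))
              (tree h (o + copyOffset h i) (b + pathLength i h)) (branches h i o ((b + pathLength i h) + extra h))
          | length-clear h (o + copyOffset h i) (b + pathLength i h)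
          | length-clearBranches h i o ((b + pathLength i h) + extra h)
          | length-range b (pathLength i h) = refl

  order-pos : ∀ h → 0 < order h
  order-pos zero    = s≤s z≤n
  order-pos (suc h) = s≤s z≤n

  Span : ℕ → ℕ → ℕ → Pred
  Span h o b x = Interval o (order h) x ⊎ Interval b (extra h) x

  SpanBelowRoot : ℕ → ℕ → ℕ → Pred
  SpanBelowRoot h o b x = (o < x × x < o + order h) ⊎ Interval b (extra h) x

  SpanBranches : ℕ → ℕ → ℕ → ℕ → Pred
  SpanBranches h i o b x = (o < x × x < o + copyOffset h i) ⊎ Interval b (extraBranches h i) x

  SpanBelowRoot⇒Span : ∀ h {o b x} → SpanBelowRoot h o b x → Span h o b x
  SpanBelowRoot⇒Span h (inj₁ (o<x , x<)) = inj₁ (<⇒≤ o<x , x<)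
  SpanBelowRoot⇒Span h (inj₂ y)          = inj₂ y

  -- In the first of the branches h (suc i) o b, the subtree has root c, the path is
  -- b, …, b′ − 1, and the subdivision vertices of the subtree start at b′, those of the
  -- remaining branches at b″.
  module Copy (h i o b : ℕ) where
    c = o + copyOffset h i
    ℓ = pathLength i h
    b′ = b + ℓ
    b″ = b′ + extra h

    o<c : o < c
    o<c = m<m+n o (s≤s z≤n)

    c<c+order : c < c + order h
    c<c+order = m<m+n c (order-pos h)

    c+order≡ : c + order h ≡ o + copyOffset h (suc i)
    c+order≡ rewrite +-assoc o (copyOffset h i) (order h) | +-comm (i * order h) (order h) = refl

    b″+extra≡ : b″ + extraBranches h i ≡ b + extraBranches h (suc i)
    b″+extra≡ rewrite +-assoc b ℓ (extra h) | +-assoc b (ℓ + extra h) (extraBranches h i) = refl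

    b≤b′ : b ≤ b′
    b≤b′ = m≤m+n b ℓ

    b′≤b″ : b′ ≤ b″
    b′≤b″ = m≤m+n b′ (extra h)

    b≤b″ : b ≤ b″
    b≤b″ = ≤-trans b≤b′ b′≤b″

    b″≤end : b″ ≤ b + extraBranches h (suc i)
    b″≤end = subst (b″ ≤_) b″+extra≡ (m≤m+n b″ (extraBranches h i))

    c-inSpan : SpanBranches h (suc i) o b c
    c-inSpan = inj₁ (o<c , subst (c <_) c+order≡ c<c+order)

    path-inSpan : ∀ {x} → Interval b ℓ x → SpanBranches h (suc i) o b x
    path-inSpan (b≤x , x<b′) = inj₂ (b≤x , <-≤-trans x<b′ (≤-trans b′≤b″ b″≤end))

    subtree-inSpan : ∀ {x} → Span h c b′ x → SpanBranches h (suc i) o b x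
    subtree-inSpan {x} (inj₁ (c≤x , x<)) = inj₁ (<-≤-trans o<c c≤x , subst (x <_) c+order≡ x<)
    subtree-inSpan     (inj₂ (b′≤x , x<)) = inj₂ (≤-trans b≤b′ b′≤x , <-≤-trans x< b″≤end)

    rest-inSpan : ∀ {x} → SpanBranches h i o b″ x → SpanBranches h (suc i) o b x
    rest-inSpan     (inj₁ (o<x , x<c)) = inj₁ (o<x , <-trans x<c (subst (c <_) c+order≡ c<c+order))
    rest-inSpan {x} (inj₂ (b″≤x , x<)) = inj₂ (≤-trans b≤b″ b″≤x , subst (x <_) b″+extra≡ x<)

  treeEdges-within : ∀ h o b → Within (Span h o b) (treeEdges h o b)
  branchesEdges-within : ∀ h i o b → Within (λ x → x ≡ o ⊎ SpanBranches h i o b x) (branchesEdges h i o b)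

  treeEdges-within zero    o b _ _ ()
  treeEdges-within (suc h) o b = Within-mono root-or-below (branchesEdges-within h m o b)
    where
    root-or-below : ∀ x → x ≡ o ⊎ SpanBranches h m o b x → Span (suc h) o b x
    root-or-below x (inj₁ refl) = inj₁ (≤-refl , m<m+n o (s≤s z≤n))
    root-or-below x (inj₂ y)    = SpanBelowRoot⇒Span (suc h) y
  branchesEdges-within h zero    o b _ _ ()
  branchesEdges-within h (suc i) o b =
    Within-++ (path o c b ℓ) _ (Within-mono on-path (path-within o c b ℓ))
      (Within-++ (treeEdges h c b′) _ (Within-mono (λ _ → inj₂ ∘ subtree-inSpan) (treeEdges-within h c b′))
        (Within-mono (λ _ → [ inj₁ , inj₂ ∘ rest-inSpan ]′) (branchesEdges-within h i o b″)))
    where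
    open Copy h i o b
    on-path : ∀ x → PathVertex o c b ℓ x → x ≡ o ⊎ SpanBranches h (suc i) o b x
    on-path x (inj₁ x≡o)        = inj₁ x≡o
    on-path x (inj₂ (inj₁ refl)) = inj₂ c-inSpan
    on-path x (inj₂ (inj₂ p))   = inj₂ (path-inSpan p)

  InTree-tree⇒Span : ∀ h o b {x} → InTree (tree h o b) x → Span h o b x
  InBranches-subtrees : ∀ h o b {x} → InBranches (subtrees h o b) x → SpanBelowRoot h o b x
  InBranches-branches : ∀ h i o b {x} → InBranches (branches h i o b) x → SpanBranches h i o b x

  InTree-tree⇒Span h o b (inj₁ refl) = inj₁ (≤-refl , m<m+n o (order-pos h))
  InTree-tree⇒Span h o b (inj₂ y)    = SpanBelowRoot⇒Span h (InBranches-subtrees h o b y)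
  InBranches-subtrees (suc h) o b y = InBranches-branches h m o b y
  InBranches-branches h (suc i) o b (inj₁ (inj₁ m)) = Copy.path-inSpan h i o b (range⁻ b (pathLength i h) m)
  InBranches-branches h (suc i) o b (inj₁ (inj₂ y)) =
    Copy.subtree-inSpan h i o b (InTree-tree⇒Span h (Copy.c h i o b) (Copy.b′ h i o b) y)
  InBranches-branches h (suc i) o b (inj₂ y) = Copy.rest-inSpan h i o b (InBranches-branches h i o (Copy.b″ h i o b) y)

  Span⇒InTree-tree : ∀ h o b {x} → Span h o b x → InTree (tree h o b) x
  SpanBranches⇒InBranches : ∀ h i o b {x} → SpanBranches h i o b x → InBranches (branches h i o b) x

  Span⇒InTree-tree zero    o b (inj₁ i) = inj₁ (Interval-singleton i)
  Span⇒InTree-tree zero    o b (inj₂ i) = ⊥-elim (Interval-empty i)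
  Span⇒InTree-tree (suc h) o b {x} (inj₁ (o≤x , x<)) with o ≟ x
  ... | yes refl = inj₁ refl
  ... | no o≢x   = inj₂ (SpanBranches⇒InBranches h m o b (inj₁ (≤∧≢⇒< o≤x o≢x , x<)))
  Span⇒InTree-tree (suc h) o b (inj₂ y) = inj₂ (SpanBranches⇒InBranches h m o b (inj₂ y))

  SpanBranches⇒InBranches h zero    o b (inj₁ (o<x , x<o+1)) = ⊥-elim (>⇒≢ o<x (Interval-singleton (<⇒≤ o<x , x<o+1)))
  SpanBranches⇒InBranches h zero    o b (inj₂ i) = ⊥-elim (Interval-empty i)
  SpanBranches⇒InBranches h (suc i) o b {x} (inj₁ (o<x , x<)) with x <? Copy.c h i o b
  ... | yes x<c = inj₂ (SpanBranches⇒InBranches h i o (Copy.b″ h i o b) (inj₁ (o<x , x<c)))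
  ... | no x≮c  = inj₁ (inj₂ (Span⇒InTree-tree h (Copy.c h i o b) (Copy.b′ h i o b)
                    (inj₁ (≮⇒≥ x≮c , subst (x <_) (sym (Copy.c+order≡ h i o b)) x<))))
  SpanBranches⇒InBranches h (suc i) o b {x} (inj₂ (b≤x , x<)) with x <? Copy.b′ h i o b | x <? Copy.b″ h i o b
  ... | yes x<b′ | _      = inj₁ (inj₁ (range⁺ b (pathLength i h) (b≤x , x<b′)))
  ... | no x≮b′ | yes x<b″ = inj₁ (inj₂ (Span⇒InTree-tree h (Copy.c h i o b) (Copy.b′ h i o b) (inj₂ (≮⇒≥ x≮b′ , x<b″))))
  ... | no _    | no x≮b″  = inj₂ (SpanBranches⇒InBranches h i o (Copy.b″ h i o b)
                               (inj₂ (≮⇒≥ x≮b″ , subst (x <_) (sym (Copy.b″+extra≡ h i o b)) x<)))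

  -- The copy's original vertices lie below b, so its pieces occupy disjoint intervals:
  -- o < [o+1, c) < [c, c + order h) < [b, b′) < [b′, b″) < [b″, …).
  module Placed (h i o b : ℕ) (fits : o + copyOffset h (suc i) ≤ b) where
    open Copy h i o b public

    c+order≤b : c + order h ≤ b
    c+order≤b = subst (_≤ b) (sym c+order≡) fits

    c<b : c < b
    c<b = <-≤-trans c<c+order c+order≤b

    o<b : o < b
    o<b = <-trans o<c c<b

    subtree-fits : c + order h ≤ b′
    subtree-fits = ≤-trans c+order≤b b≤b′

    rest-fits : o + copyOffset h i ≤ b″
    rest-fits = ≤-trans (<⇒≤ c<b) b≤b″

    Rest : Pred
    Rest = SpanBranches h i o b″

    o∉path : Interval b ℓ o → ⊥
    o∉path (b≤o , _) = <⇒≱ o<b b≤o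

    o∉subtree : Span h c b′ o → ⊥
    o∉subtree (inj₁ (c≤o , _)) = <⇒≱ o<c c≤o
    o∉subtree (inj₂ (b′≤o , _)) = <⇒≱ (<-≤-trans o<b b≤b′) b′≤o

    o∉rest : Rest o → ⊥
    o∉rest (inj₁ (o<o , _)) = <-irrefl refl o<o
    o∉rest (inj₂ (b″≤o , _)) = <⇒≱ (<-≤-trans o<b b≤b″) b″≤o

    c∉path : Interval b ℓ c → ⊥
    c∉path (b≤c , _) = <⇒≱ c<b b≤c

    c∉belowRoot : SpanBelowRoot h c b′ c → ⊥
    c∉belowRoot (inj₁ (c<c , _)) = <-irrefl refl c<c
    c∉belowRoot (inj₂ (b′≤c , _)) = <⇒≱ (<-≤-trans c<b b≤b′) b′≤c

    c∉rest : Rest c → ⊥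
    c∉rest (inj₁ (_ , c<c)) = <-irrefl refl c<c
    c∉rest (inj₂ (b″≤c , _)) = <⇒≱ (<-≤-trans c<b b≤b″) b″≤c

    path-disjoint-subtree : ∀ {x} → Interval b ℓ x → Span h c b′ x → ⊥
    path-disjoint-subtree (b≤x , _)   (inj₁ (_ , x<)) = <⇒≱ (<-≤-trans x< c+order≤b) b≤x
    path-disjoint-subtree (_ , x<b′) (inj₂ (b′≤x , _)) = <⇒≱ x<b′ b′≤x

    path-disjoint-rest : ∀ {x} → Interval b ℓ x → Rest x → ⊥
    path-disjoint-rest (b≤x , _)   (inj₁ (_ , x<c)) = <⇒≱ (<-trans x<c c<b) b≤x
    path-disjoint-rest (_ , x<b′) (inj₂ (b″≤x , _)) = <⇒≱ (<-≤-trans x<b′ b′≤b″) b″≤x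

    subtree-disjoint-rest : ∀ {x} → Span h c b′ x → Rest x → ⊥
    subtree-disjoint-rest (inj₁ (c≤x , _))  (inj₁ (_ , x<c))  = <⇒≱ x<c c≤x
    subtree-disjoint-rest (inj₁ (_ , x<))   (inj₂ (b″≤x , _)) = <⇒≱ (<-≤-trans x< (≤-trans c+order≤b b≤b″)) b″≤x
    subtree-disjoint-rest (inj₂ (b′≤x , _)) (inj₁ (_ , x<c))  = <⇒≱ (<-trans x<c (<-≤-trans c<b b≤b′)) b′≤x
    subtree-disjoint-rest (inj₂ (_ , x<b″)) (inj₂ (b″≤x , _)) = <⇒≱ x<b″ b″≤x

    copyEdges : List (ℕ × ℕ)
    copyEdges = path o c b ℓ ++ (treeEdges h c b′ ++ branchesEdges h i o b″)

    below-path-within : Within (λ x → Span h c b′ x ⊎ (x ≡ o ⊎ Rest x)) (treeEdges h c b′ ++ branchesEdges h i o b″)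
    below-path-within = Within-++ (treeEdges h c b′) _
      (Within-mono (λ _ → inj₁) (treeEdges-within h c b′)) (Within-mono (λ _ → inj₂) (branchesEdges-within h i o b″))

    path-wf-in-copy : WfPath copyEdges o (range b ℓ) c
    path-wf-in-copy = WfPath-extend (range b ℓ) c only-path (path-wf o c b ℓ o<b c<b)
      where
      only-path : ∀ {u x} → x ∈ range b ℓ → Edge copyEdges u x → Edge (path o c b ℓ) u x
      only-path m = Edge-++ˡ (path o c b ℓ) _ below-path-within
        [ path-disjoint-subtree p , [ (λ { refl → o∉path p }) , path-disjoint-rest p ]′ ]′
        where p = range⁻ b ℓ m

    subtree-wf-in-copy : WfTree (treeEdges h c b′) (lastOf o (range b ℓ)) (tree h c b′) →
      WfTree copyEdges (lastOf o (range b ℓ)) (tree h c b′)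
    subtree-wf-in-copy = WfTree-attach c (subtrees h c b′) only-subtree at-root
      where
      only-subtree : ∀ {u x} → InBranches (subtrees h c b′) x → Edge copyEdges u x → Edge (treeEdges h c b′) u x
      only-subtree {x = x} y e =
        Edge-++ˡ (treeEdges h c b′) _ (branchesEdges-within h i o b″) not-rest
          (Edge-++ʳ (path o c b ℓ) _ (path-within o c b ℓ) not-on-path e)
        where
        below = InBranches-subtrees h c b′ y
        inside = SpanBelowRoot⇒Span h below
        not-on-path : PathVertex o c b ℓ x → ⊥
        not-on-path (inj₁ refl)        = o∉subtree inside
        not-on-path (inj₂ (inj₁ refl)) = c∉belowRoot below
        not-on-path (inj₂ (inj₂ p))    = path-disjoint-subtree p inside
        not-rest : x ≡ o ⊎ Rest x → ⊥
        not-rest (inj₁ refl) = o∉subtree inside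
        not-rest (inj₂ r)    = subtree-disjoint-rest inside r
      at-root : ∀ u → Edge copyEdges u c → Edge (treeEdges h c b′) u c ⊎ u ≡ lastOf o (range b ℓ)
      at-root u e with Edge-++⁻ (path o c b ℓ) _ e
      ... | inj₁ e-path = inj₂ (path-neighbour-end ℓ (<⇒≢ o<c) c<b e-path)
      ... | inj₂ e-below with Edge-++⁻ (treeEdges h c b′) _ e-below
      ...   | inj₁ e-subtree = inj₁ e-subtree
      ...   | inj₂ e-rest    = ⊥-elim ([ (λ c≡o → <⇒≢ o<c (sym c≡o)) , c∉rest ]′
                                        (Edge-within (branchesEdges-within h i o b″) e-rest))

    rest-wf-in-copy : WfBranches (branchesEdges h i o b″) o (branches h i o b″) →
      WfBranches copyEdges o (branches h i o b″)
    rest-wf-in-copy = WfBranches-extend (branches h i o b″) only-rest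
      where
      only-rest : ∀ {u x} → InBranches (branches h i o b″) x → Edge copyEdges u x → Edge (branchesEdges h i o b″) u x
      only-rest {x = x} y e =
        Edge-++ʳ (treeEdges h c b′) _ (treeEdges-within h c b′) (λ s → subtree-disjoint-rest s r)
          (Edge-++ʳ (path o c b ℓ) _ (path-within o c b ℓ) not-on-path e)
        where
        r = InBranches-branches h i o b″ y
        not-on-path : PathVertex o c b ℓ x → ⊥
        not-on-path (inj₁ refl)        = o∉rest r
        not-on-path (inj₂ (inj₁ refl)) = c∉rest r
        not-on-path (inj₂ (inj₂ p))    = path-disjoint-rest p r

    root-neighbour : ∀ {u} → Edge copyEdges u o → u ≡ firstOf (range b ℓ) c ⊎ Edge (branchesEdges h i o b″) u o
    root-neighbour e with Edge-++⁻ (path o c b ℓ) _ e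
    ... | inj₁ e-path  = inj₁ (path-neighbour-start ℓ (<⇒≢ o<c) o<b e-path)
    ... | inj₂ e-below = inj₂ (Edge-++ʳ (treeEdges h c b′) _ (treeEdges-within h c b′) o∉subtree e-below)

  tree-wf : ∀ h o b {up} → o + order h ≤ b → WfTree (treeEdges h o b) up (tree h o b)
  branches-at-root : ∀ h i o b → o + copyOffset h i ≤ b →
    ∀ {u} → Edge (branchesEdges h i o b) u o → BranchTop (branches h i o b) u
  branches-wf : ∀ h i o b → o + copyOffset h i ≤ b → WfBranches (branchesEdges h i o b) o (branches h i o b)

  tree-wf zero    o b fits = (λ u e → ⊥-elim (Edge-[] e)) , tt
  tree-wf (suc h) o b fits = (λ u e → inj₂ (branches-at-root h m o b fits e)) , branches-wf h m o b fits
  branches-at-root h zero    o b fits e = ⊥-elim (Edge-[] e)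
  branches-at-root h (suc i) o b fits e =
    [ inj₁ , inj₂ ∘ branches-at-root h i o b″ rest-fits ]′ (root-neighbour e)
    where open Placed h i o b fits
  branches-wf h zero    o b fits = tt
  branches-wf h (suc i) o b fits =
    path-wf-in-copy ,
    subtree-wf-in-copy (tree-wf h c b′ subtree-fits) ,
    rest-wf-in-copy (branches-wf h i o b″ rest-fits) ,
    ≤-reflexive (trans (length-clearBranches h i o b″) (sym (length-range b ℓ)))
    where open Placed h i o b fits

  module Stemmed (d : ℕ) where
    n = order d

    stemCounts : Counts (edges (That m d))
    stemCounts = 0 ∷ counts d

    W : Graph
    W = subdivide (That m d) stemCounts

    t : Tree
    t = tree d 0 (suc n)

    subdivEdges-That : subdivEdges (edges (That m d)) stemCounts (size (That m d)) ≡
      ((0 , n) ∷ treeEdges d 0 (suc n) , suc n + extra d)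
    subdivEdges-That
      rewrite subdivEdges≡subdivEdgesAt0 (edges (That m d)) stemCounts (size (That m d))
            | subdivEdgesAt-T d 0 (suc n + 0) | +-identityʳ n = refl

    W-wf : WfTree (edges W) n t
    W-wf = subst (λ E → WfTree E n t) (sym (cong proj₁ subdivEdges-That))
      (WfTree-stem 0 (subtrees d 0 (suc n)) (<⇒≢ (order-pos d)) away (tree-wf d 0 (suc n) (n≤1+n n)))
      where
      away : ∀ {x} → InBranches (subtrees d 0 (suc n)) x → x ≢ 0 × x ≢ n
      away y with InBranches-subtrees d 0 (suc n) y
      ... | inj₁ (0<x , x<n)  = >⇒≢ 0<x , <⇒≢ x<n
      ... | inj₂ (n<x , _)    = >⇒≢ (<-≤-trans (s≤s z≤n) n<x) , >⇒≢ n<x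

    covered : ∀ {v} → v < size W → InTree t v ⊎ v ≡ n
    covered {v} v<size with v <? n | n ≟ v
    ... | yes v<n | _        = inj₁ (Span⇒InTree-tree d 0 (suc n) (inj₁ (z≤n , v<n)))
    ... | no _    | yes refl = inj₂ refl
    ... | no v≮n  | no n≢v   = inj₁ (Span⇒InTree-tree d 0 (suc n)
                                 (inj₂ (≤∧≢⇒< (≮⇒≥ v≮n) n≢v , subst (v <_) (cong proj₂ subdivEdges-That) v<size)))

    protocol : List (List ℕ)
    protocol = clear t ++ ((n ∷ []) ∷ [])

    protocol-width : HasWidth≤ 2 protocol
    protocol-width = ++⁺ (clear-width t) (s≤s z≤n ∷ [])

    protocol-clears : Clears W protocol
    protocol-clears = triple⇒Clears W protocol (clear-stemmed-triple W t W-wf) covered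

theorem5p7 : (m d : ℕ) → 2 ≤ m → 1 ≤ d →
    Σ Graph (λ W → IsSubdivisionOf W (That m d) × i11≤ W 2)
theorem5p7 m d _ _ = W , (stemCounts , refl) , protocol , protocol-width , protocol-clears
  where open Construction.Stemmed m d
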